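{- Let $N$ be a network and let $G_1$ and $G_2$ be rooted partners of $N$. Then every edge in $E_{DP}(N)$ has the same direction in $G_1$ and in $G_2$.
   Context: A semidirected graph is $N=(V,E)$ with $E=E_U\sqcup E_D$, $E_U$ undirected edges $uv$, $E_D$ directed edges $(u,v)$ ($u$ parent, $v$ child); parallel directed edges allowed, no self-loops. $\deg_i(v,N)$ is the number of directed edges with child $v$. $N'$ is compatible with $N$ if obtained by directing some undirected edges. A semidirected cycle is a semidirected graph whose undirected edges can be directed to make it a directed cycle; acyclic (SDAG) means containing no semidirected cycle; DAG = acyclic directed graph. Tree node: $\deg_i\le1$; hybrid node otherwise. Hybrid edge: directed edge with hybrid child; $E_H(N)$ their set. SDAG $N'$ is phylogenetically compatible with SDAG $N$ if compatible and $E_H(N')=E_H(N)$; a rooted partner of $N$ is a DAG phylogenetically compatible with $N$; a network is an SDAG admitting a rooted partner. A semidirected path from $u_0$ to $u_n$ is $u_0\dots u_n$ with $u_{i-1}u_i$ or $(u_{i-1},u_i)$ an edge for each $i$; $v\lesssim u$ if there is a semidirected path from $u$ to $v$; $u\sim v$ if $u\lesssim v$ and $v\lesssim u$. An undirected component is the subgraph induced by a $\sim$-class; a root component is one whose class is maximal under $\lesssim$. $E_{DP}(N)$ (the directed part) is the set of edges of $N$ not in any root component. -}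

module Defs where

open import Data.Nat using (ℕ; zero; suc; _≤_)
open import Data.Fin using (Fin; inject₁; fromℕ) renaming (suc to fsuc; zero to fzero)
open import Data.Fin.Properties using (_≟_)
open import Data.Bool using (Bool; true; false; if_then_else_)
open import Data.List using (List; map)
open import Data.Nat.ListAction using (sum)
open import Data.List using () renaming (allFin to allFinL)
open import Data.Product using (Σ; ∃; _×_; _,_)
open import Data.Sum using (_⊎_)
open import Data.Empty using (⊥)
open import Relation.Nullary using (¬_; does)
open import Relation.Binary.PropositionalEquality using (_≡_; _≢_)
open import Relation.Binary.Construct.Closure.ReflexiveTransitive using (Star)

-- A finite mixed graph on vertices Fin n with edges indexed by Fin m.  If dir e = true, it is the directed
-- edge (src e , tgt e) (parent src e, child tgt e); if dir e = false it is
-- the undirected edge {src e , tgt e} (the order of src/tgt is then irrelevant).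
record Graph (n m : ℕ) : Set where
  field
    src tgt : Fin m → Fin n
    dir     : Fin m → Bool
open Graph public

SameEnds : ∀ {n} → Fin n → Fin n → Fin n → Fin n → Set
SameEnds a b c d = (a ≡ c × b ≡ d) ⊎ (a ≡ d × b ≡ c)

-- Semidirected graph: no self-loops; parallel directed edges allowed, but
-- E_U is a set of undirected edges (no two distinct undirected edges with the
-- same endpoints).
IsSemidirected : ∀ {n m} → Graph n m → Set
IsSemidirected {n} {m} N =
  (∀ e → src N e ≢ tgt N e) ×
  (∀ e e' → dir N e ≡ false → dir N e' ≡ false →
     SameEnds (src N e) (tgt N e) (src N e') (tgt N e') → e ≡ e')

-- N' is compatible with N: obtained by directing some undirected edges
-- (edges are identified by their index).
Compatible : ∀ {n m} → Graph n m → Graph n m → Set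
Compatible {n} {m} N' N = ∀ e →
  (dir N e ≡ true × dir N' e ≡ true × src N' e ≡ src N e × tgt N' e ≡ tgt N e)
  ⊎ (dir N e ≡ false × SameEnds (src N' e) (tgt N' e) (src N e) (tgt N e))

Traverses : ∀ {n m} → Graph n m → Fin m → Fin n → Fin n → Set
Traverses N e a b =
  (dir N e ≡ true × src N e ≡ a × tgt N e ≡ b)
  ⊎ (dir N e ≡ false × SameEnds (src N e) (tgt N e) a b)

record SemidirectedCycle {n m} (N : Graph n m) : Set where
  field
    k     : ℕ
    2≤k   : 2 ≤ k
    vs    : Fin (suc k) → Fin n
    es    : Fin k → Fin m
    closed : vs (fromℕ k) ≡ vs fzero
    vinj  : ∀ i j → vs (inject₁ i) ≡ vs (inject₁ j) → i ≡ j
    einj  : ∀ i j → es i ≡ es j → i ≡ j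
    step  : ∀ i → Traverses N (es i) (vs (inject₁ i)) (vs (fsuc i))

Acyclic : ∀ {n m} → Graph n m → Set
Acyclic N = ¬ SemidirectedCycle N

SDAG : ∀ {n m} → Graph n m → Set
SDAG N = IsSemidirected N × Acyclic N

IsDAG : ∀ {n m} → Graph n m → Set
IsDAG N = SDAG N × (∀ e → dir N e ≡ true)

inDeg : ∀ {n m} → Graph n m → Fin n → ℕ
inDeg {n} {m} N v =
  sum (map (λ e → if dir N e then (if does (tgt N e ≟ v) then 1 else 0) else 0)
           (allFinL m))

IsHybridNode : ∀ {n m} → Graph n m → Fin n → Set
IsHybridNode N v = 2 ≤ inDeg N v

IsHybridEdge : ∀ {n m} → Graph n m → Fin m → Set
IsHybridEdge N e = dir N e ≡ true × IsHybridNode N (tgt N e)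

PhylCompatible : ∀ {n m} → Graph n m → Graph n m → Set
PhylCompatible N' N =
  SDAG N' × SDAG N × Compatible N' N ×
  (∀ e → (IsHybridEdge N' e → IsHybridEdge N e) × (IsHybridEdge N e → IsHybridEdge N' e))

RootedPartner : ∀ {n m} → Graph n m → Graph n m → Set
RootedPartner G N = IsDAG G × PhylCompatible G N

IsNetwork : ∀ {n m} → Graph n m → Set
IsNetwork N = SDAG N × ∃ λ G → RootedPartner G N

Step : ∀ {n m} → Graph n m → Fin n → Fin n → Set
Step N a b = ∃ λ e → Traverses N e a b

SDPath : ∀ {n m} → Graph n m → Fin n → Fin n → Set
SDPath N = Star (Step N)

_≲⟨_⟩_ : ∀ {n m} → Fin n → Graph n m → Fin n → Set
v ≲⟨ N ⟩ u = SDPath N u v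

_∼⟨_⟩_ : ∀ {n m} → Fin n → Graph n m → Fin n → Set
u ∼⟨ N ⟩ v = (u ≲⟨ N ⟩ v) × (v ≲⟨ N ⟩ u)

InRootClass : ∀ {n m} → Graph n m → Fin n → Set
InRootClass N u = ∀ w → u ≲⟨ N ⟩ w → w ≲⟨ N ⟩ u

-- e lies in a root component: both endpoints in the same ∼-class, and that
-- class is maximal (root components are induced subgraphs).
InRootComponent : ∀ {n m} → Graph n m → Fin m → Set
InRootComponent N e = (src N e ∼⟨ N ⟩ tgt N e) × InRootClass N (src N e)

InDirectedPart : ∀ {n m} → Graph n m → Fin m → Set
InDirectedPart N e = ¬ InRootComponent N e

-- Suppose an undirected edge e of N is oriented u → v in one rooted partner and v → u in the
-- other.  An edge that is undirected in N is not a hybrid edge, so in every rooted partner its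
-- child has no other parent.  Now follow any semidirected path of N that starts at the child
-- of a directed edge, keeping a stack of edges that form a directed path in BOTH partners:
-- an edge oriented forwards in both partners is pushed, and an edge oriented backwards in
-- one of them enters the current vertex there, so by uniqueness of parents it is the top
-- of the stack and is popped.  Arriving at the endpoint of e that e enters in the second
-- partner, the same argument makes e the top of the stack, so e would be a loop in the
-- first partner.  Hence the endpoints of e are unreachable from children of directed edges,
-- which forces them into a root component.
module Submission where

open import Defs
open import Data.Nat using (ℕ; _+_; _≤_)
open import Data.Nat.Properties using (≤-trans; m≤m+n; m≤n+m; +-monoʳ-≤; +-comm)
open import Data.Fin using (Fin) renaming (suc to fsuc; zero to fzero)
open import Data.Fin.Properties using (_≟_)
open import Data.Bool using (Bool; true; false; if_then_else_)
open import Data.List using (tabulate)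
open import Data.List.Properties using (map-tabulate)
open import Data.Nat.ListAction using (sum)
open import Data.Product using (_×_; _,_; proj₁; proj₂)
open import Data.Sum using (_⊎_; inj₁; inj₂)
open import Data.Empty using (⊥; ⊥-elim)
open import Relation.Nullary using (¬_; does; yes; no)
open import Relation.Binary.PropositionalEquality using (_≡_; _≢_; refl; sym; trans; subst; cong)
open import Relation.Binary.Construct.Closure.ReflexiveTransitive using (ε; _◅_; _◅◅_)

lookup≤sum-tabulate : ∀ {m} (g : Fin m → ℕ) i → g i ≤ sum (tabulate g)
lookup≤sum-tabulate g fzero    = m≤m+n (g fzero) _
lookup≤sum-tabulate g (fsuc i) =
  ≤-trans (lookup≤sum-tabulate (λ j → g (fsuc j)) i) (m≤n+m _ (g fzero))

lookup-pair≤sum-tabulate : ∀ {m} (g : Fin m → ℕ) i j → i ≢ j → g i + g j ≤ sum (tabulate g)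
lookup-pair≤sum-tabulate g fzero    fzero    i≢j = ⊥-elim (i≢j refl)
lookup-pair≤sum-tabulate g fzero    (fsuc j) i≢j =
  +-monoʳ-≤ (g fzero) (lookup≤sum-tabulate (λ k → g (fsuc k)) j)
lookup-pair≤sum-tabulate g (fsuc i) fzero    i≢j =
  subst (_≤ sum (tabulate g)) (+-comm (g fzero) (g (fsuc i)))
    (+-monoʳ-≤ (g fzero) (lookup≤sum-tabulate (λ k → g (fsuc k)) i))
lookup-pair≤sum-tabulate g (fsuc i) (fsuc j) i≢j =
  ≤-trans (lookup-pair≤sum-tabulate (λ k → g (fsuc k)) i j (λ eq → i≢j (cong fsuc eq)))
          (m≤n+m _ (g fzero))

two-parents⇒hybrid : ∀ {n m} (G : Graph n m) {h f} → h ≢ f → dir G h ≡ true → dir G f ≡ true →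
  tgt G h ≡ tgt G f → IsHybridNode G (tgt G f)
two-parents⇒hybrid {m = m} G {h} {f} h≢f h-dir f-dir h↦v =
  subst (2 ≤_) (cong sum (sym (map-tabulate (λ e → e) counts)))
    (subst (_≤ sum (tabulate counts)) (counts-one h h-dir h↦v +₁ counts-one f f-dir refl)
      (lookup-pair≤sum-tabulate counts h f h≢f))
  where
  v : Fin _
  v = tgt G f
  counts : Fin m → ℕ
  counts e = if dir G e then (if does (tgt G e ≟ v) then 1 else 0) else 0
  counts-one : ∀ e → dir G e ≡ true → tgt G e ≡ v → counts e ≡ 1
  counts-one e e-dir e↦v rewrite e-dir with tgt G e ≟ v
  ... | yes _  = refl
  ... | no e↛v = ⊥-elim (e↛v e↦v)
  _+₁_ : ∀ {a b} → a ≡ 1 → b ≡ 1 → a + b ≡ 2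
  refl +₁ refl = refl

directed∧undirected⇒⊥ : {b : Bool} → b ≡ true → b ≡ false → ⊥
directed∧undirected⇒⊥ refl ()

Arc : ∀ {n m} → Graph n m → Fin m → Fin n → Fin n → Set
Arc G e u v = src G e ≡ u × tgt G e ≡ v

module _ {n m} {N G : Graph n m} where

  compatible-orientation : Compatible G N → ∀ e →
    Arc G e (src N e) (tgt N e) ⊎ (dir N e ≡ false × Arc G e (tgt N e) (src N e))
  compatible-orientation c e with c e
  ... | inj₁ (_ , _ , s , t)           = inj₁ (s , t)
  ... | inj₂ (_ , inj₁ (s , t))        = inj₁ (s , t)
  ... | inj₂ (e-undir , inj₂ (s , t)) = inj₂ (e-undir , s , t)

  traversal-orientation : Compatible G N → ∀ {f y y'} → Traverses N f y y' →
    Arc G f y y' ⊎ (dir N f ≡ false × Arc G f y' y)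
  traversal-orientation c {f} (inj₁ (_ , refl , refl))        = compatible-orientation c f
  traversal-orientation c {f} (inj₂ (_ , inj₁ (refl , refl))) = compatible-orientation c f
  traversal-orientation c {f} (inj₂ (f-undir , inj₂ (refl , refl)))
    with compatible-orientation c f
  ... | inj₁ arc       = inj₂ (f-undir , arc)
  ... | inj₂ (_ , arc) = inj₁ arc

  directed-child : Compatible G N → ∀ {d} → dir N d ≡ true → tgt G d ≡ tgt N d
  directed-child c {d} d-dir with c d
  ... | inj₁ (_ , _ , _ , t)  = t
  ... | inj₂ (d-undir , _)    = ⊥-elim (directed∧undirected⇒⊥ d-dir d-undir)

  partner-loop-free : RootedPartner G N → ∀ e → src G e ≢ tgt G e
  partner-loop-free ((((loop-free , _) , _) , _) , _) = loop-free

  partner-all-directed : RootedPartner G N → ∀ e → dir G e ≡ true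
  partner-all-directed ((_ , all-directed) , _) = all-directed

  partner-compatible : RootedPartner G N → Compatible G N
  partner-compatible (_ , _ , _ , compatible , _) = compatible

  partner-hybrid⇒hybrid : RootedPartner G N → ∀ e → IsHybridEdge G e → IsHybridEdge N e
  partner-hybrid⇒hybrid (_ , _ , _ , _ , hybrid-edges-agree) e = proj₁ (hybrid-edges-agree e)

  -- An edge undirected in N is not hybrid in N, hence not in G: its child has no other parent.
  undirected-parent-unique : RootedPartner G N → ∀ {f h} → dir N f ≡ false →
    tgt G h ≡ tgt G f → h ≡ f
  undirected-parent-unique partner {f} {h} f-undir h↦v with h ≟ f
  ... | yes h≡f = h≡f
  ... | no  h≢f = ⊥-elim (directed∧undirected⇒⊥ (proj₁ f-hybrid-in-N) f-undir)
    where
    all-directed : ∀ e → dir G e ≡ true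
    all-directed = partner-all-directed partner
    f-hybrid-in-N : IsHybridEdge N f
    f-hybrid-in-N = partner-hybrid⇒hybrid partner f
      (all-directed f , two-parents⇒hybrid G h≢f (all-directed h) (all-directed f) h↦v)

  undirected-not-into-directed-child : RootedPartner G N → ∀ {f d} → dir N f ≡ false →
    dir N d ≡ true → tgt G f ≢ tgt N d
  undirected-not-into-directed-child partner f-undir d-dir f↦x
    with undirected-parent-unique partner f-undir
           (trans (directed-child (partner-compatible partner) d-dir) (sym f↦x))
  ... | refl = directed∧undirected⇒⊥ d-dir f-undir

module CommonPaths {n m} {N G₁ G₂ : Graph n m}
  (partner₁ : RootedPartner G₁ N) (partner₂ : RootedPartner G₂ N) where

  CommonArc : Fin m → Fin n → Fin n → Set
  CommonArc h u v = Arc G₁ h u v × Arc G₂ h u v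

  data CommonPath : Fin n → Set where
    start : ∀ {d} → dir N d ≡ true → CommonPath (tgt N d)
    _▷_   : ∀ {h u v} → CommonPath u → CommonArc h u v → CommonPath v

  pop : ∀ {G} → RootedPartner G N → (∀ {h u v} → CommonArc h u v → Arc G h u v) →
    ∀ {f y} → CommonPath y → dir N f ≡ false → tgt G f ≡ y → CommonPath (src G f)
  pop partner arc (start d-dir) f-undir f↦y =
    ⊥-elim (undirected-not-into-directed-child partner f-undir d-dir f↦y)
  pop partner arc (path ▷ common) f-undir f↦y
    with undirected-parent-unique partner f-undir (trans (proj₂ (arc common)) (sym f↦y))
  ... | refl = subst CommonPath (sym (proj₁ (arc common))) path

  extend : ∀ {f y y'} → CommonPath y → Traverses N f y y' → CommonPath y'
  extend path step with traversal-orientation (partner-compatible partner₁) step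
                      | traversal-orientation (partner-compatible partner₂) step
  ... | inj₂ (f-undir , s₁ , t₁) | _ = subst CommonPath s₁ (pop partner₁ proj₁ path f-undir t₁)
  ... | inj₁ _ | inj₂ (f-undir , s₂ , t₂) = subst CommonPath s₂ (pop partner₂ proj₂ path f-undir t₂)
  ... | inj₁ arc₁ | inj₁ arc₂ = path ▷ (arc₁ , arc₂)

  follow : ∀ {y z} → CommonPath y → SDPath N y z → CommonPath z
  follow path ε                = path
  follow path ((_ , step) ◅ p) = follow (extend path step) p

  no-reversed-edge-at-end : ∀ {e a} → CommonPath a → dir N e ≡ false →
    src G₁ e ≡ a → tgt G₂ e ≡ a → ⊥
  no-reversed-edge-at-end (start d-dir) e-undir _ e↦a =
    undirected-not-into-directed-child partner₂ e-undir d-dir e↦a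
  no-reversed-edge-at-end (path ▷ ((_ , h↦a₁) , (_ , h↦a₂))) e-undir a↦e e↦a
    with undirected-parent-unique partner₂ e-undir (trans h↦a₂ (sym e↦a))
  ... | refl = partner-loop-free partner₁ _ (trans a↦e (sym h↦a₁))

reversed-edge-unreachable : ∀ {n m} {N G₁ G₂ : Graph n m} →
  RootedPartner G₁ N → RootedPartner G₂ N → ∀ {e a} → dir N e ≡ false →
  src G₁ e ≡ a → tgt G₂ e ≡ a → ∀ {d} → dir N d ≡ true → ¬ SDPath N (tgt N d) a
reversed-edge-unreachable partner₁ partner₂ e-undir a↦e e↦a d-dir p =
  no-reversed-edge-at-end (follow (start d-dir) p) e-undir a↦e e↦a
  where open CommonPaths partner₁ partner₂

-- A path into s can only use undirected edges, and those can be walked backwards.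
unreachable⇒inRootClass : ∀ {n m} (N : Graph n m) {s} →
  (∀ {d} → dir N d ≡ true → ¬ SDPath N (tgt N d) s) → InRootClass N s
unreachable⇒inRootClass N unreachable w ε = ε
unreachable⇒inRootClass N unreachable w ((f , inj₁ (f-dir , _ , refl)) ◅ p) =
  ⊥-elim (unreachable f-dir p)
unreachable⇒inRootClass N unreachable w ((f , inj₂ (f-undir , ends)) ◅ p) =
  unreachable⇒inRootClass N unreachable _ p ◅◅ ((f , inj₂ (f-undir , swap-ends ends)) ◅ ε)
  where
  swap-ends : ∀ {a b c d : Fin _} → SameEnds a b c d → SameEnds a b d c
  swap-ends (inj₁ (p , q)) = inj₂ (p , q)
  swap-ends (inj₂ (p , q)) = inj₁ (p , q)

reversed-edge-in-root-component : ∀ {n m} {N G₁ G₂ : Graph n m} →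
  RootedPartner G₁ N → RootedPartner G₂ N → ∀ {e} → dir N e ≡ false →
  src G₁ e ≡ src N e → tgt G₂ e ≡ src N e → InRootComponent N e
reversed-edge-in-root-component {N = N} partner₁ partner₂ {e} e-undir a↦e e↦a =
  (((e , backward) ◅ ε) , ((e , forward) ◅ ε)) ,
  unreachable⇒inRootClass N (reversed-edge-unreachable partner₁ partner₂ e-undir a↦e e↦a)
  where
  forward : Traverses N e (src N e) (tgt N e)
  forward  = inj₂ (e-undir , inj₁ (refl , refl))
  backward : Traverses N e (tgt N e) (src N e)
  backward = inj₂ (e-undir , inj₂ (refl , refl))

proposition6 : ∀ {n m} (N G₁ G₂ : Graph n m) → IsNetwork N →
    RootedPartner G₁ N → RootedPartner G₂ N →
    ∀ e → InDirectedPart N e → (src G₁ e ≡ src G₂ e) × (tgt G₁ e ≡ tgt G₂ e)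
proposition6 N G₁ G₂ _ partner₁ partner₂ e e∉root
  with compatible-orientation (partner-compatible partner₁) e
     | compatible-orientation (partner-compatible partner₂) e
... | inj₁ (s₁ , t₁) | inj₁ (s₂ , t₂) = trans s₁ (sym s₂) , trans t₁ (sym t₂)
... | inj₂ (_ , s₁ , t₁) | inj₂ (_ , s₂ , t₂) = trans s₁ (sym s₂) , trans t₁ (sym t₂)
... | inj₁ (s₁ , _) | inj₂ (e-undir , _ , t₂) =
  ⊥-elim (e∉root (reversed-edge-in-root-component partner₁ partner₂ e-undir s₁ t₂))
... | inj₂ (e-undir , _ , t₁) | inj₁ (s₂ , _) =
  ⊥-elim (e∉root (reversed-edge-in-root-component partner₂ partner₁ e-undir s₂ t₁))
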